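{- Let $L$ be either $\mathbf{IL}^-(\mathbf{J2}_{+})$ or $\mathbf{CL}$. For any modal formula $A$, the following are equivalent: 1. $L \vdash A$. 2. $A$ is valid in all (finite) simplified $L$-frames. In particular, $\mathbf{CL}$ has the finite model property with respect to simplified $\mathbf{CL}$-frames.
   Context: Modal formulas of interpretability logic are built from propositional variables, $\top$, $\bot$, $\to,\lor,\land$, the unary modality $\Box$ and the binary modality $\rhd$; $\Diamond A :\equiv \lnot\Box\lnot A$. The logic $\mathbf{IL}^-$ has the axioms: all tautologies; $\Box(A\to B)\to(\Box A\to\Box B)$; $\Box(\Box A\to A)\to\Box A$; $\mathbf{J3}$: $(A\rhd C)\land(B\rhd C)\to(A\lor B)\rhd C$; $\mathbf{J6}$: $\Box\lnot A\leftrightarrow A\rhd\bot$; and the rules Modus Ponens, Necessitation, $\dfrac{A\to B}{C\rhd A\to C\rhd B}$ and $\dfrac{A\to B}{B\rhd C\to A\rhd C}$. Further axioms: $\mathbf{J1}$: $\Box(A\to B)\to A\rhd B$; $\mathbf{J2}$: $(A\rhd B)\land(B\rhd C)\to A\rhd C$; $\mathbf{J2}_+$: $A\rhd(B\lor C)\land B\rhd C\to A\rhd C$; $\mathbf{J4}$: $A\rhd B\to(\Diamond A\to\Diamond B)$; $\mathbf{J4}_+$: $\Box(A\to B)\to(C\rhd A\to C\rhd B)$. $L(\Sigma_1,\dots,\Sigma_n)$ denotes the extension of $L$ by the axioms $\Sigma_i$. The logic $\mathbf{CL}$ of conservativity is $\mathbf{IL}$ without $\mathbf{J5}$ ($\Diamond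 A\rhd A$), i.e. axioms tautologies, the two $\Box$-axioms above, $\mathbf{J1},\mathbf{J2},\mathbf{J3},\mathbf{J4}$, with Modus Ponens and Necessitation; it is deductively equivalent to $\mathbf{IL}^-(\mathbf{J1},\mathbf{J2})$ (and over $\mathbf{IL}^-(\mathbf{J1})$ one may identify $\mathbf{J2}_+$ with $\mathbf{J2}$). A simplified $\mathbf{IL}^-(\mathbf{J4}_+)$-frame is a triple $(W,R,S)$ where $W$ is a nonempty set, $R$ is a transitive and conversely well-founded binary relation on $W$, and $S$ is an arbitrary binary relation on $W$. A model adds a forcing relation $\Vdash$ with the usual clauses, $x\Vdash\Box A$ iff $y\Vdash A$ for all $y$ with $xRy$, and $x\Vdash A\rhd B$ iff for all $y$ with $xRy$ and $y\Vdash A$ there exists $z$ with $xRz$, $ySz$ and $z\Vdash B$. A formula is valid in a frame if it is forced at every point under every forcing relation on the frame. A simplified $\mathbf{IL}^-(\mathbf{J2}_+)$-frame is such a frame with $S$ transitive; a simplified $\mathbf{CL}$-frame is such a frame with $S$ reflexive and transitive. The frame is finite if $W$ is finite. -}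

module Defs where

open import Level using (0ℓ)
open import Data.Nat using (ℕ)
open import Data.Bool using (Bool; true; false; _∧_; _∨_; not)
open import Data.Fin using (Fin)
open import Data.Product using (Σ; _×_; ∃-syntax)
open import Data.Sum using (_⊎_)
open import Data.Unit using () renaming (⊤ to Unit)
open import Data.Empty using () renaming (⊥ to Empty)
open import Relation.Binary.PropositionalEquality using (_≡_)
open import Relation.Binary.Definitions using (Transitive; Reflexive)
open import Induction.WellFounded using (WellFounded)
open import Function.Bundles using (_↔_)

infixr 6 _∧'_
infixr 5 _∨'_
infixr 4 _⇒_
infix 7 _▷_

data Fm : Set where
  var  : ℕ → Fm
  ⊤'   : Fm
  ⊥'   : Fm
  _⇒_  : Fm → Fm → Fm
  _∨'_ : Fm → Fm → Fm
  _∧'_ : Fm → Fm → Fm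
  □    : Fm → Fm
  _▷_  : Fm → Fm → Fm

¬' : Fm → Fm
¬' A = A ⇒ ⊥'

◇ : Fm → Fm
◇ A = ¬' (□ (¬' A))

_⇔'_ : Fm → Fm → Fm
A ⇔' B = (A ⇒ B) ∧' (B ⇒ A)

-- Propositional tautologies: formulas true under every Boolean
-- assignment to their "propositional atoms" (variables, □-formulas,
-- ▷-formulas), i.e. substitution instances of propositional tautologies.

_⇒ᵇ_ : Bool → Bool → Bool
a ⇒ᵇ b = not a ∨ b

evalᵇ : (Fm → Bool) → Fm → Bool
evalᵇ v (var p)  = v (var p)
evalᵇ v ⊤'       = true
evalᵇ v ⊥'       = false
evalᵇ v (A ⇒ B)  = evalᵇ v A ⇒ᵇ evalᵇ v B
evalᵇ v (A ∨' B) = evalᵇ v A ∨ evalᵇ v B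
evalᵇ v (A ∧' B) = evalᵇ v A ∧ evalᵇ v B
evalᵇ v (□ A)    = v (□ A)
evalᵇ v (A ▷ B)  = v (A ▷ B)

Tautology : Fm → Set
Tautology A = (v : Fm → Bool) → evalᵇ v A ≡ true

data IL⁻ (Ax : Fm → Set) : Fm → Set where
  taut : ∀ {A} → Tautology A → IL⁻ Ax A
  K    : ∀ A B → IL⁻ Ax (□ (A ⇒ B) ⇒ (□ A ⇒ □ B))
  Löb  : ∀ A → IL⁻ Ax (□ (□ A ⇒ A) ⇒ □ A)
  J3   : ∀ A B C → IL⁻ Ax (((A ▷ C) ∧' (B ▷ C)) ⇒ ((A ∨' B) ▷ C))
  J6   : ∀ A → IL⁻ Ax (□ (¬' A) ⇔' (A ▷ ⊥'))
  ax   : ∀ {A} → Ax A → IL⁻ Ax A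
  MP   : ∀ {A B} → IL⁻ Ax (A ⇒ B) → IL⁻ Ax A → IL⁻ Ax B
  Nec  : ∀ {A} → IL⁻ Ax A → IL⁻ Ax (□ A)
  R1   : ∀ {A B} C → IL⁻ Ax (A ⇒ B) → IL⁻ Ax ((C ▷ A) ⇒ (C ▷ B))
  R2   : ∀ {A B} C → IL⁻ Ax (A ⇒ B) → IL⁻ Ax ((B ▷ C) ⇒ (A ▷ C))

data J2₊ : Fm → Set where
  j2₊ : ∀ A B C → J2₊ (((A ▷ (B ∨' C)) ∧' (B ▷ C)) ⇒ (A ▷ C))

-- The logic CL (IL without J5)

data CL⊢ : Fm → Set where
  taut : ∀ {A} → Tautology A → CL⊢ A
  K    : ∀ A B → CL⊢ (□ (A ⇒ B) ⇒ (□ A ⇒ □ B))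
  Löb  : ∀ A → CL⊢ (□ (□ A ⇒ A) ⇒ □ A)
  J1   : ∀ A B → CL⊢ (□ (A ⇒ B) ⇒ (A ▷ B))
  J2   : ∀ A B C → CL⊢ (((A ▷ B) ∧' (B ▷ C)) ⇒ (A ▷ C))
  J3   : ∀ A B C → CL⊢ (((A ▷ C) ∧' (B ▷ C)) ⇒ ((A ∨' B) ▷ C))
  J4   : ∀ A B → CL⊢ ((A ▷ B) ⇒ (◇ A ⇒ ◇ B))
  MP   : ∀ {A B} → CL⊢ (A ⇒ B) → CL⊢ A → CL⊢ B
  Nec  : ∀ {A} → CL⊢ A → CL⊢ (□ A)

data Logic : Set where
  IL⁻J2₊ CL : Logic

_⊢_ : Logic → Fm → Set
IL⁻J2₊ ⊢ A = IL⁻ J2₊ A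
CL     ⊢ A = CL⊢ A

record Frame : Set₁ where
  field
    W : Set
    R : W → W → Set
    S : W → W → Set
open Frame public

-- simplified IL⁻(J4₊)-frame: W nonempty, R transitive and conversely
-- well-founded, S arbitrary
IsSimplified : Frame → Set
IsSimplified F =
  W F × Transitive (R F) × WellFounded (λ x y → R F y x)

SCond : Logic → Frame → Set
SCond IL⁻J2₊ F = Transitive (S F)
SCond CL     F = Reflexive (S F) × Transitive (S F)

IsSimplifiedLFrame : Logic → Frame → Set
IsSimplifiedLFrame L F = IsSimplified F × SCond L F

IsFinite : Frame → Set
IsFinite F = ∃[ n ] (W F ↔ Fin n)

Forces : (F : Frame) → (W F → ℕ → Set) → W F → Fm → Set
Forces F V x (var p)  = V x p
Forces F V x ⊤'       = Unit
Forces F V x ⊥'       = Empty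
Forces F V x (A ⇒ B)  = Forces F V x A → Forces F V x B
Forces F V x (A ∨' B) = Forces F V x A ⊎ Forces F V x B
Forces F V x (A ∧' B) = Forces F V x A × Forces F V x B
Forces F V x (□ A)    = (y : W F) → R F x y → Forces F V y A
Forces F V x (A ▷ B)  =
  (y : W F) → R F x y → Forces F V y A →
  Σ (W F) λ z → R F x z × S F y z × Forces F V z B

ValidIn : Frame → Fm → Set₁
ValidIn F A = (V : W F → ℕ → Set) (x : W F) → Forces F V x A

ValidAll : Logic → Fm → Set₁
ValidAll L A = (F : Frame) → IsSimplifiedLFrame L F → ValidIn F A

ValidFinite : Logic → Fm → Set₁
ValidFinite L A =
  (F : Frame) → IsSimplifiedLFrame L F → IsFinite F → ValidIn F A

-- Soundness is checked axiom by axiom on simplified frames; tautologies hold because excluded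
-- middle turns forcing at a world into a Boolean valuation.  Since CL derives R1, R2, J6 and J2₊,
-- both logics are theories over IL⁻(J2₊), and one countermodel construction serves for both.
--
-- Given an unprovable A₀, take a finite set Φ containing the subformulas of A₀, the formulas □ ¬ E
-- for antecedents E of ▷-subformulas, and "markers" □ (P ⇒ N ∨ ⋁ S) for subformulas P, N and sets
-- S of antecedents.  Worlds are maximal consistent subsets ("atoms") of Φ, tagged; R is the GL
-- successor relation on atoms (boxes are kept and opened, and a new box appears), well-founded
-- because the number of boxes grows.  To falsify C ▷ D at u one needs a successor containing C
-- all of whose S-successors refute D; such a successor is tagged as a source, and it S-sees only
-- targets that are D-critical for u, i.e. refute every E with E ▷ D in u.  Refuting a marker yields
-- critical successors; that the needed markers are refutable is where J3, J4₊ and J2₊ enter.  The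
-- two logics differ only in whether S is reflexive, which in CL forces the source itself to refute D.

module Submission where

open import Defs
open import Level using (0ℓ)
open import Data.Nat using (ℕ; zero; suc; _+_; _*_; _≤_; _<_; _∸_; z≤n; s≤s)
open import Data.Nat.Properties using (m≤n⇒m≤1+n; ∸-monoʳ-<)
open import Data.Nat.Induction using (<-wellFounded)
open import Data.Fin using (Fin; zero; suc)
open import Data.Fin.Properties using (1↔⊤; 2↔Bool; *↔×; +↔⊎)
open import Data.Vec using (Vec; []; _∷_)
import Data.Vec as Vec
open import Data.Vec.Properties using (lookup-map)
open import Data.List using (List; []; _∷_; _++_; length; map; concatMap; lookup)
open import Data.List.Properties using (length-map)
open import Data.List.Membership.Propositional using (_∈_)
open import Data.List.Membership.Propositional.Properties
  using (∈-++⁺ˡ; ∈-++⁺ʳ; ∈-map⁺; ∈-concatMap⁺; ∈-lookup)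
open import Data.List.Relation.Binary.Subset.Propositional using (_⊆_)
open import Data.List.Relation.Unary.Any using (here; there; index)
import Data.List.Relation.Unary.Any as Any
open import Data.List.Relation.Unary.Any.Properties using (lookup-index)
open import Data.Bool using (Bool; true; false; _∧_; _∨_; if_then_else_; T)
open import Data.Bool.Properties using (T-∧; T-∨; T-≡)
open import Data.Product using (Σ; _×_; _,_; proj₁; proj₂; ∃-syntax)
open import Data.Product.Function.NonDependent.Propositional using (_×-⇔_; _×-↔_)
open import Data.Sum using (_⊎_; inj₁; inj₂)
import Data.Sum as Sum
open import Data.Sum.Function.Propositional using (_⊎-⇔_; _⊎-↔_)
open import Data.Unit using (⊤; tt)
open import Data.Empty using (⊥; ⊥-elim)
open import Relation.Nullary using (¬_; yes; no)
open import Relation.Nullary.Decidable using (isYes; toWitness; fromWitness)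
open import Relation.Binary.PropositionalEquality using (_≡_; refl; sym; trans; cong₂; subst)
open import Relation.Binary.Definitions using (Reflexive; Transitive)
open import Induction.WellFounded using (WellFounded; Acc; acc; module Subrelation)
import Relation.Binary.Construct.On as On
open import Function using (id; _∘_)
open import Function.Bundles using (_↔_; _⇔_; mk⇔; mk↔ₛ′; Equivalence)
open import Function.Properties.Inverse using (↔-refl; ↔-sym; ↔-trans)
open import Function.Related.TypeIsomorphisms using (→-cong-⇔)
import Function.Properties.Equivalence as ⇔
open import Axiom.ExcludedMiddle using (ExcludedMiddle)

private variable
  n : ℕ
  A B C D E G M P X Y : Fm
  Ψ : List Fm

-- Propositional schemata, checked by truth tables

infixr 4 _⇒ₛ_
infixr 5 _∨ₛ_
infixr 6 _∧ₛ_

data Schema (n : ℕ) : Set where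
  #_             : Fin n → Schema n
  ⊤ₛ ⊥ₛ          : Schema n
  _⇒ₛ_ _∨ₛ_ _∧ₛ_ : Schema n → Schema n → Schema n

infix 7 ¬ₛ_
¬ₛ_ : Schema n → Schema n
¬ₛ s = s ⇒ₛ ⊥ₛ

_[_] : Schema n → Vec Fm n → Fm
(# i) [ ρ ]    = Vec.lookup ρ i
⊤ₛ [ ρ ]       = ⊤'
⊥ₛ [ ρ ]       = ⊥'
(s ⇒ₛ t) [ ρ ] = s [ ρ ] ⇒ t [ ρ ]
(s ∨ₛ t) [ ρ ] = s [ ρ ] ∨' t [ ρ ]
(s ∧ₛ t) [ ρ ] = s [ ρ ] ∧' t [ ρ ]

evalₛ : Schema n → Vec Bool n → Bool
evalₛ (# i)    bs = Vec.lookup bs i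
evalₛ ⊤ₛ       bs = true
evalₛ ⊥ₛ       bs = false
evalₛ (s ⇒ₛ t) bs = evalₛ s bs ⇒ᵇ evalₛ t bs
evalₛ (s ∨ₛ t) bs = evalₛ s bs ∨ evalₛ t bs
evalₛ (s ∧ₛ t) bs = evalₛ s bs ∧ evalₛ t bs

evalᵇ-[] : ∀ v (s : Schema n) ρ → evalᵇ v (s [ ρ ]) ≡ evalₛ s (Vec.map (evalᵇ v) ρ)
evalᵇ-[] v (# i)    ρ = sym (lookup-map i (evalᵇ v) ρ)
evalᵇ-[] v ⊤ₛ       ρ = refl
evalᵇ-[] v ⊥ₛ       ρ = refl
evalᵇ-[] v (s ⇒ₛ t) ρ = cong₂ _⇒ᵇ_ (evalᵇ-[] v s ρ) (evalᵇ-[] v t ρ)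
evalᵇ-[] v (s ∨ₛ t) ρ = cong₂ _∨_ (evalᵇ-[] v s ρ) (evalᵇ-[] v t ρ)
evalᵇ-[] v (s ∧ₛ t) ρ = cong₂ _∧_ (evalᵇ-[] v s ρ) (evalᵇ-[] v t ρ)

everywhere : ∀ n → (Vec Bool n → Bool) → Bool
everywhere zero    f = f []
everywhere (suc n) f = everywhere n (λ bs → f (true ∷ bs)) ∧ everywhere n (λ bs → f (false ∷ bs))

everywhere-sound : ∀ n f → T (everywhere n f) → ∀ bs → T (f bs)
everywhere-sound zero    f h []           = h
everywhere-sound (suc n) f h (true ∷ bs)  = everywhere-sound n _ (proj₁ (Equivalence.to T-∧ h)) bs
everywhere-sound (suc n) f h (false ∷ bs) = everywhere-sound n _ (proj₂ (Equivalence.to T-∧ h)) bs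

ValidSchema : Schema n → Set
ValidSchema {n} s = T (everywhere n (evalₛ s))

instance-tautology : (s : Schema n) → {ValidSchema s} → (ρ : Vec Fm n) → Tautology (s [ ρ ])
instance-tautology {n} s {valid} ρ v =
  trans (evalᵇ-[] v s ρ) (Equivalence.to T-≡ (everywhere-sound n (evalₛ s) valid (Vec.map (evalᵇ v) ρ)))

p₀ : Schema (suc n)
p₀ = # zero
p₁ : Schema (suc (suc n))
p₁ = # suc zero
p₂ : Schema (suc (suc (suc n)))
p₂ = # suc (suc zero)
p₃ : Schema (suc (suc (suc (suc n))))
p₃ = # suc (suc (suc zero))
p₄ : Schema (suc (suc (suc (suc (suc n)))))
p₄ = # suc (suc (suc (suc zero)))

record Theory : Set₁ where
  field
    Thm       : Fm → Set
    tautology : Tautology A → Thm A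
    mp        : Thm (A ⇒ B) → Thm A → Thm B
    nec       : Thm A → Thm (□ A)
    ax-K      : ∀ A B → Thm (□ (A ⇒ B) ⇒ (□ A ⇒ □ B))
    ax-Löb    : ∀ A → Thm (□ (□ A ⇒ A) ⇒ □ A)
    ax-J3     : ∀ A B C → Thm ((A ▷ C) ∧' (B ▷ C) ⇒ (A ∨' B) ▷ C)
    ax-J6     : ∀ A → Thm (□ (¬' A) ⇔' (A ▷ ⊥'))
    ax-J2₊    : ∀ A B C → Thm ((A ▷ (B ∨' C)) ∧' (B ▷ C) ⇒ A ▷ C)
    rule-R1   : ∀ C → Thm (A ⇒ B) → Thm (C ▷ A ⇒ C ▷ B)
    rule-R2   : ∀ C → Thm (A ⇒ B) → Thm (B ▷ C ⇒ A ▷ C)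

module Derived (𝓣 : Theory) where
  open Theory 𝓣 public

  tauto : (s : Schema n) → {ValidSchema s} → (ρ : Vec Fm n) → Thm (s [ ρ ])
  tauto s {valid} ρ = tautology (instance-tautology s {valid} ρ)

  mp₂ : Thm (A ⇒ B ⇒ C) → Thm A → Thm B → Thm C
  mp₂ f a b = mp (mp f a) b

  ⇒-trans : Thm (A ⇒ B) → Thm (B ⇒ C) → Thm (A ⇒ C)
  ⇒-trans {A} {B} {C} = mp₂ (tauto ((p₀ ⇒ₛ p₁) ⇒ₛ (p₁ ⇒ₛ p₂) ⇒ₛ p₀ ⇒ₛ p₂) (A ∷ B ∷ C ∷ []))

  infix 3 _⊢ₕ_
  _⊢ₕ_ : Fm → Fm → Set
  G ⊢ₕ A = Thm (G ⇒ A)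

  ⊢ₕ-const : Thm A → G ⊢ₕ A
  ⊢ₕ-const {A} {G} = mp (tauto (p₀ ⇒ₛ p₁ ⇒ₛ p₀) (A ∷ G ∷ []))

  ⊢ₕ-refl : G ⊢ₕ G
  ⊢ₕ-refl {G} = tauto (p₀ ⇒ₛ p₀) (G ∷ [])

  ⊢ₕ-mp : G ⊢ₕ A ⇒ B → G ⊢ₕ A → G ⊢ₕ B
  ⊢ₕ-mp {G} {A} {B} = mp₂ (tauto ((p₀ ⇒ₛ p₁ ⇒ₛ p₂) ⇒ₛ (p₀ ⇒ₛ p₁) ⇒ₛ p₀ ⇒ₛ p₂) (G ∷ A ∷ B ∷ []))

  ⊢ₕ-map : Thm (A ⇒ B) → G ⊢ₕ A → G ⊢ₕ B
  ⊢ₕ-map f = ⊢ₕ-mp (⊢ₕ-const f)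

  ⊢ₕ-pair : G ⊢ₕ A → G ⊢ₕ B → G ⊢ₕ A ∧' B
  ⊢ₕ-pair {G} {A} {B} = mp₂ (tauto ((p₀ ⇒ₛ p₁) ⇒ₛ (p₀ ⇒ₛ p₂) ⇒ₛ p₀ ⇒ₛ p₁ ∧ₛ p₂) (G ∷ A ∷ B ∷ []))

  ⊢ₕ-map₂ : Thm (A ∧' B ⇒ C) → G ⊢ₕ A → G ⊢ₕ B → G ⊢ₕ C
  ⊢ₕ-map₂ f a b = ⊢ₕ-map f (⊢ₕ-pair a b)

  ⊢ₕ-fst : G ⊢ₕ A ∧' B → G ⊢ₕ A
  ⊢ₕ-fst {A = A} {B = B} = ⊢ₕ-map (tauto (p₀ ∧ₛ p₁ ⇒ₛ p₀) (A ∷ B ∷ []))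

  ⊢ₕ-snd : G ⊢ₕ A ∧' B → G ⊢ₕ B
  ⊢ₕ-snd {A = A} {B = B} = ⊢ₕ-map (tauto (p₀ ∧ₛ p₁ ⇒ₛ p₁) (A ∷ B ∷ []))

  ⊢ₕ-∧ʳ : G ⊢ₕ A → B ∧' G ⊢ₕ A
  ⊢ₕ-∧ʳ {G} {B = B} = ⇒-trans (tauto (p₀ ∧ₛ p₁ ⇒ₛ p₁) (B ∷ G ∷ []))

  Consistent : Fm → Set
  Consistent X = ¬ Thm (¬' X)

  □-mono : Thm (A ⇒ B) → Thm (□ A ⇒ □ B)
  □-mono {A} {B} f = mp (ax-K A B) (nec f)

  ⊢ₕ-□-mono : Thm (A ⇒ B) → G ⊢ₕ □ A → G ⊢ₕ □ B
  ⊢ₕ-□-mono f = ⊢ₕ-map (□-mono f)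

  □-∧ : ∀ A B → Thm (□ A ⇒ □ B ⇒ □ (A ∧' B))
  □-∧ A B = ⇒-trans (□-mono (tauto (p₀ ⇒ₛ p₁ ⇒ₛ p₀ ∧ₛ p₁) (A ∷ B ∷ []))) (ax-K B (A ∧' B))

  ⊢ₕ-□-∧ : G ⊢ₕ □ A → G ⊢ₕ □ B → G ⊢ₕ □ (A ∧' B)
  ⊢ₕ-□-∧ {A = A} {B = B} a b = ⊢ₕ-mp (⊢ₕ-map (□-∧ A B) a) b

  -- Transitivity of □ follows from Löb's axiom applied to □ A ∧ A.
  □-4 : ∀ A → Thm (□ A ⇒ □ (□ A))
  □-4 A = ⇒-trans (⇒-trans (□-mono A⇒□H⇒H) (ax-Löb H)) (□-mono (tauto (p₀ ∧ₛ p₁ ⇒ₛ p₀) (□ A ∷ A ∷ [])))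
    where
      H : Fm
      H = □ A ∧' A
      A⇒□H⇒H : Thm (A ⇒ □ H ⇒ H)
      A⇒□H⇒H = mp (tauto ((p₁ ⇒ₛ p₂) ⇒ₛ p₀ ⇒ₛ p₁ ⇒ₛ p₂ ∧ₛ p₀) (A ∷ □ H ∷ □ A ∷ []))
                  (□-mono (tauto (p₀ ∧ₛ p₁ ⇒ₛ p₁) (□ A ∷ A ∷ [])))

  □-⊤ : Thm (□ ⊤')
  □-⊤ = nec (tauto ⊤ₛ [])

  J6⇒ : ∀ C → Thm (□ (¬' C) ⇒ C ▷ ⊥')
  J6⇒ C = mp (tauto (p₀ ∧ₛ p₁ ⇒ₛ p₀) (_ ∷ _ ∷ [])) (ax-J6 C)

  J6⇐ : ∀ C → Thm (C ▷ ⊥' ⇒ □ (¬' C))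
  J6⇐ C = mp (tauto (p₀ ∧ₛ p₁ ⇒ₛ p₁) (_ ∷ _ ∷ [])) (ax-J6 C)

  ⊥▷ : ∀ D → Thm (⊥' ▷ D)
  ⊥▷ D = mp (rule-R1 ⊥' (tauto (⊥ₛ ⇒ₛ p₀) (D ∷ []))) (mp (J6⇒ ⊥') (nec (tauto (⊥ₛ ⇒ₛ ⊥ₛ) [])))

  ⊢ₕ-J2₊ : G ⊢ₕ A ▷ (B ∨' C) → G ⊢ₕ B ▷ C → G ⊢ₕ A ▷ C
  ⊢ₕ-J2₊ = ⊢ₕ-map₂ (ax-J2₊ _ _ _)

  ⊢ₕ-J3 : G ⊢ₕ A ▷ C → G ⊢ₕ B ▷ C → G ⊢ₕ (A ∨' B) ▷ C
  ⊢ₕ-J3 = ⊢ₕ-map₂ (ax-J3 _ _ _)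

  -- J4₊, via C ▷ (D ∧ ¬Y) ∨ Y and (D ∧ ¬Y) ▷ ⊥.
  ⊢ₕ-J4₊ : G ⊢ₕ C ▷ D → G ⊢ₕ □ (D ⇒ Y) → G ⊢ₕ C ▷ Y
  ⊢ₕ-J4₊ {C = C} {D = D} {Y = Y} C▷D □D⇒Y = ⊢ₕ-J2₊ (⊢ₕ-map (rule-R1 C split) C▷D) D∧¬Y▷Y
    where
      split : Thm (D ⇒ (D ∧' ¬' Y) ∨' Y)
      split = tauto (p₀ ⇒ₛ (p₀ ∧ₛ ¬ₛ p₁) ∨ₛ p₁) (D ∷ Y ∷ [])
      D∧¬Y▷Y : _ ⊢ₕ (D ∧' ¬' Y) ▷ Y
      D∧¬Y▷Y = ⊢ₕ-map (rule-R1 _ (tauto (⊥ₛ ⇒ₛ p₀) (Y ∷ [])))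
                 (⊢ₕ-map (J6⇒ _) (⊢ₕ-□-mono (tauto ((p₀ ⇒ₛ p₁) ⇒ₛ (p₀ ∧ₛ ¬ₛ p₁) ⇒ₛ ⊥ₛ) (D ∷ Y ∷ [])) □D⇒Y))

  ⊢ₕ-□▷ : G ⊢ₕ □ (C ⇒ Y) → G ⊢ₕ Y ▷ D → G ⊢ₕ C ▷ D
  ⊢ₕ-□▷ {C = C} {Y = Y} {D = D} □C⇒Y Y▷D = ⊢ₕ-map (rule-R2 D split) (⊢ₕ-J3 C∧¬Y▷D Y▷D)
    where
      split : Thm (C ⇒ (C ∧' ¬' Y) ∨' Y)
      split = tauto (p₀ ⇒ₛ (p₀ ∧ₛ ¬ₛ p₁) ∨ₛ p₁) (C ∷ Y ∷ [])
      C∧¬Y▷D : _ ⊢ₕ (C ∧' ¬' Y) ▷ D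
      C∧¬Y▷D = ⊢ₕ-map (rule-R1 _ (tauto (⊥ₛ ⇒ₛ p₀) (D ∷ [])))
                 (⊢ₕ-map (J6⇒ _) (⊢ₕ-□-mono (tauto ((p₀ ⇒ₛ p₁) ⇒ₛ (p₀ ∧ₛ ¬ₛ p₁) ⇒ₛ ⊥ₛ) (C ∷ Y ∷ [])) □C⇒Y))

IL⁻J2₊-theory : Theory
IL⁻J2₊-theory = record
  { Thm = IL⁻ J2₊ ; tautology = taut ; mp = MP ; nec = Nec ; ax-K = K ; ax-Löb = Löb ; ax-J3 = J3
  ; ax-J6 = J6 ; ax-J2₊ = λ A B C → ax (j2₊ A B C) ; rule-R1 = R1 ; rule-R2 = R2 }

CL-tauto : (s : Schema n) → {ValidSchema s} → (ρ : Vec Fm n) → CL⊢ (s [ ρ ])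
CL-tauto s {valid} ρ = taut (instance-tautology s {valid} ρ)

CL-▷-refl : ∀ D → CL⊢ (D ▷ D)
CL-▷-refl D = MP (J1 D D) (Nec (CL-tauto (p₀ ⇒ₛ p₀) (D ∷ [])))

CL-R1 : ∀ C → CL⊢ (A ⇒ B) → CL⊢ (C ▷ A ⇒ C ▷ B)
CL-R1 {A} {B} C A⇒B =
  MP (MP (CL-tauto ((p₀ ∧ₛ p₁ ⇒ₛ p₂) ⇒ₛ p₁ ⇒ₛ p₀ ⇒ₛ p₂) (C ▷ A ∷ A ▷ B ∷ C ▷ B ∷ [])) (J2 C A B))
     (MP (J1 A B) (Nec A⇒B))

CL-R2 : ∀ C → CL⊢ (A ⇒ B) → CL⊢ (B ▷ C ⇒ A ▷ C)
CL-R2 {A} {B} C A⇒B =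
  MP (MP (CL-tauto ((p₀ ∧ₛ p₁ ⇒ₛ p₂) ⇒ₛ p₀ ⇒ₛ p₁ ⇒ₛ p₂) (A ▷ B ∷ B ▷ C ∷ A ▷ C ∷ [])) (J2 A B C))
     (MP (J1 A B) (Nec A⇒B))

-- J1 gives one direction of J6, J4 with the theorem □ ¬ ⊥ the other.
CL-J6 : ∀ A → CL⊢ (□ (¬' A) ⇔' (A ▷ ⊥'))
CL-J6 A =
  MP (MP (MP (CL-tauto ((p₁ ⇒ₛ p₀) ⇒ₛ (p₀ ⇒ₛ ¬ₛ p₁ ⇒ₛ p₂ ⇒ₛ ⊥ₛ) ⇒ₛ p₂ ⇒ₛ (p₁ ⇒ₛ p₀) ∧ₛ (p₀ ⇒ₛ p₁))
                      (A ▷ ⊥' ∷ □ (¬' A) ∷ □ (¬' ⊥') ∷ []))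
             (J1 A ⊥'))
         (J4 A ⊥'))
     (Nec (CL-tauto (⊥ₛ ⇒ₛ ⊥ₛ) []))

CL-J2₊ : ∀ A B C → CL⊢ ((A ▷ (B ∨' C)) ∧' (B ▷ C) ⇒ A ▷ C)
CL-J2₊ A B C =
  MP (MP (MP (CL-tauto ((p₁ ∧ₛ p₃ ⇒ₛ p₄) ⇒ₛ (p₀ ∧ₛ p₄ ⇒ₛ p₂) ⇒ₛ p₃ ⇒ₛ p₀ ∧ₛ p₁ ⇒ₛ p₂)
                      (A ▷ (B ∨' C) ∷ B ▷ C ∷ A ▷ C ∷ C ▷ C ∷ (B ∨' C) ▷ C ∷ []))
             (J3 B C C))
         (J2 A (B ∨' C) C))
     (CL-▷-refl C)

CL-theory : Theory
CL-theory = record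
  { Thm = CL⊢ ; tautology = taut ; mp = MP ; nec = Nec ; ax-K = K ; ax-Löb = Löb ; ax-J3 = J3
  ; ax-J6 = CL-J6 ; ax-J2₊ = CL-J2₊ ; rule-R1 = CL-R1 ; rule-R2 = CL-R2 }

theory : Logic → Theory
theory IL⁻J2₊ = IL⁻J2₊-theory
theory CL     = CL-theory

-- Soundness

module Forcing (F : Frame) (V : W F → ℕ → Set) where

  infix 3 _⊩_
  _⊩_ : W F → Fm → Set
  x ⊩ A = Forces F V x A

  T-⇒ᵇ : ∀ a b → T (a ⇒ᵇ b) ⇔ (T a → T b)
  T-⇒ᵇ true  b = mk⇔ (λ tb _ → tb) (λ f → f tt)
  T-⇒ᵇ false b = mk⇔ (λ _ ()) (λ _ → tt)

  module _ (em : ExcludedMiddle 0ℓ) (x : W F) where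
    forced : Fm → Bool
    forced A = isYes (em {x ⊩ A})

    T-forced : ∀ A → T (forced A) ⇔ (x ⊩ A)
    T-forced A = mk⇔ (toWitness {a? = em}) (fromWitness {a? = em})

    T-evalᵇ-forced : ∀ A → T (evalᵇ forced A) ⇔ (x ⊩ A)
    T-evalᵇ-forced (var p)  = T-forced (var p)
    T-evalᵇ-forced ⊤'       = mk⇔ (λ _ → tt) (λ _ → tt)
    T-evalᵇ-forced ⊥'       = mk⇔ (λ ()) (λ ())
    T-evalᵇ-forced (A ⇒ B)  = ⇔.trans (T-⇒ᵇ _ _) (→-cong-⇔ (T-evalᵇ-forced A) (T-evalᵇ-forced B))
    T-evalᵇ-forced (A ∨' B) = ⇔.trans T-∨ (T-evalᵇ-forced A ⊎-⇔ T-evalᵇ-forced B)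
    T-evalᵇ-forced (A ∧' B) = ⇔.trans T-∧ (T-evalᵇ-forced A ×-⇔ T-evalᵇ-forced B)
    T-evalᵇ-forced (□ A)    = T-forced (□ A)
    T-evalᵇ-forced (A ▷ B)  = T-forced (A ▷ B)

    ⊩-tautology : ∀ A → Tautology A → x ⊩ A
    ⊩-tautology A taut-A = Equivalence.to (T-evalᵇ-forced A) (Equivalence.from T-≡ (taut-A forced))

  ⊩-K : ∀ x A B → x ⊩ □ (A ⇒ B) ⇒ □ A ⇒ □ B
  ⊩-K x A B □A⇒B □A y xRy = □A⇒B y xRy (□A y xRy)

  ⊩-Löb : Transitive (R F) → WellFounded (λ x y → R F y x) → ∀ x A → x ⊩ □ (□ A ⇒ A) ⇒ □ A
  ⊩-Löb R-trans R-wf x A □[□A⇒A] y xRy = go y (R-wf y) xRy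
    where
      go : ∀ y → Acc (λ a b → R F b a) y → R F x y → y ⊩ A
      go y (acc rs) xRy = □[□A⇒A] y xRy (λ z yRz → go z (rs yRz) (R-trans xRy yRz))

  ⊩-J1 : Reflexive (S F) → ∀ x A B → x ⊩ □ (A ⇒ B) ⇒ A ▷ B
  ⊩-J1 S-refl x A B □A⇒B y xRy a = y , xRy , S-refl , □A⇒B y xRy a

  ⊩-J2 : Transitive (S F) → ∀ x A B C → x ⊩ (A ▷ B) ∧' (B ▷ C) ⇒ A ▷ C
  ⊩-J2 S-trans x A B C (A▷B , B▷C) y xRy a =
    let (z , xRz , ySz , b) = A▷B y xRy a
        (z′ , xRz′ , zSz′ , c) = B▷C z xRz b
    in z′ , xRz′ , S-trans ySz zSz′ , c

  ⊩-J2₊ : Transitive (S F) → ∀ x A B C → x ⊩ (A ▷ (B ∨' C)) ∧' (B ▷ C) ⇒ A ▷ C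
  ⊩-J2₊ S-trans x A B C (A▷B∨C , B▷C) y xRy a with A▷B∨C y xRy a
  ... | z , xRz , ySz , inj₂ c = z , xRz , ySz , c
  ... | z , xRz , ySz , inj₁ b = let (z′ , xRz′ , zSz′ , c) = B▷C z xRz b in z′ , xRz′ , S-trans ySz zSz′ , c

  ⊩-J3 : ∀ x A B C → x ⊩ (A ▷ C) ∧' (B ▷ C) ⇒ (A ∨' B) ▷ C
  ⊩-J3 x A B C (A▷C , B▷C) y xRy (inj₁ a) = A▷C y xRy a
  ⊩-J3 x A B C (A▷C , B▷C) y xRy (inj₂ b) = B▷C y xRy b

  ⊩-J4 : ∀ x A B → x ⊩ A ▷ B ⇒ ◇ A ⇒ ◇ B
  ⊩-J4 x A B A▷B ◇A □¬B = ◇A λ y xRy a → let (z , xRz , _ , b) = A▷B y xRy a in □¬B z xRz b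

  ⊩-J6 : ∀ x A → x ⊩ □ (¬' A) ⇔' (A ▷ ⊥')
  ⊩-J6 x A = (λ □¬A y xRy a → ⊥-elim (□¬A y xRy a)) , (λ A▷⊥ y xRy a → proj₂ (proj₂ (proj₂ (A▷⊥ y xRy a))))

  ⊩-IL⁻J2₊ : ExcludedMiddle 0ℓ → IsSimplifiedLFrame IL⁻J2₊ F → IL⁻ J2₊ A → ∀ x → x ⊩ A
  ⊩-IL⁻J2₊ em ((_ , R-trans , R-wf) , S-trans) = go
    where
      go : IL⁻ J2₊ A → ∀ x → x ⊩ A
      go (taut {A} t)     x = ⊩-tautology em x A t
      go (K A B)          x = ⊩-K x A B
      go (Löb A)          x = ⊩-Löb R-trans R-wf x A
      go (J3 A B C)       x = ⊩-J3 x A B C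
      go (J6 A)           x = ⊩-J6 x A
      go (ax (j2₊ A B C)) x = ⊩-J2₊ S-trans x A B C
      go (MP d e)         x = go d x (go e x)
      go (Nec d)          x y _ = go d y
      go (R1 C d)         x C▷A y xRy c = let (z , xRz , ySz , a) = C▷A y xRy c in z , xRz , ySz , go d z a
      go (R2 C d)         x B▷C y xRy a = B▷C y xRy (go d y a)

  ⊩-CL : ExcludedMiddle 0ℓ → IsSimplifiedLFrame CL F → CL⊢ A → ∀ x → x ⊩ A
  ⊩-CL em ((_ , R-trans , R-wf) , S-refl , S-trans) = go
    where
      go : CL⊢ A → ∀ x → x ⊩ A
      go (taut {A} t) x = ⊩-tautology em x A t
      go (K A B)      x = ⊩-K x A B
      go (Löb A)      x = ⊩-Löb R-trans R-wf x A
      go (J1 A B)     x = ⊩-J1 S-refl x A B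
      go (J2 A B C)   x = ⊩-J2 S-trans x A B C
      go (J3 A B C)   x = ⊩-J3 x A B C
      go (J4 A B)     x = ⊩-J4 x A B
      go (MP d e)     x = go d x (go e x)
      go (Nec d)      x y _ = go d y

sound : ExcludedMiddle 0ℓ → ∀ L {A} → L ⊢ A → ValidAll L A
sound em IL⁻J2₊ ⊢A F F-frame V = Forcing.⊩-IL⁻J2₊ F V em F-frame ⊢A
sound em CL     ⊢A F F-frame V = Forcing.⊩-CL F V em F-frame ⊢A

sub properSub : Fm → List Fm
sub A = A ∷ properSub A

properSub (var p)  = []
properSub ⊤'       = []
properSub ⊥'       = []
properSub (A ⇒ B)  = sub A ++ sub B
properSub (A ∨' B) = sub A ++ sub B
properSub (A ∧' B) = sub A ++ sub B
properSub (□ A)    = sub A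
properSub (A ▷ B)  = sub A ++ sub B

sub-self : A ∈ sub A
sub-self = here refl

⊆-subˡ : ∀ {F Ψ} A B → F ∷ sub A ++ sub B ⊆ Ψ → sub A ⊆ Ψ
⊆-subˡ A B h m = h (there (∈-++⁺ˡ m))

⊆-subʳ : ∀ {F Ψ} A B → F ∷ sub A ++ sub B ⊆ Ψ → sub B ⊆ Ψ
⊆-subʳ A B h m = h (there (∈-++⁺ʳ (sub A) m))

antecedents : Fm → List Fm
antecedents (A ▷ B) = A ∷ []
antecedents _       = []

∈-concatMap : ∀ {S T : Set} {f : S → List T} {x xs y} → x ∈ xs → y ∈ f x → y ∈ concatMap f xs
∈-concatMap {f = f} x∈xs y∈fx = ∈-concatMap⁺ f (Any.map (λ { refl → y∈fx }) x∈xs)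

allBoolLists : ℕ → List (List Bool)
allBoolLists zero    = [] ∷ []
allBoolLists (suc n) = map (true ∷_) (allBoolLists n) ++ map (false ∷_) (allBoolLists n)

∈-allBoolLists : ∀ bs → bs ∈ allBoolLists (length bs)
∈-allBoolLists []           = here refl
∈-allBoolLists (true ∷ bs)  = ∈-++⁺ˡ (∈-map⁺ (true ∷_) (∈-allBoolLists bs))
∈-allBoolLists (false ∷ bs) = ∈-++⁺ʳ (map (true ∷_) _) (∈-map⁺ (false ∷_) (∈-allBoolLists bs))

∈-allBoolLists-map : ∀ {S : Set} (f : S → Bool) xs → map f xs ∈ allBoolLists (length xs)
∈-allBoolLists-map f xs = subst (λ k → map f xs ∈ allBoolLists k) (length-map f xs) (∈-allBoolLists (map f xs))

module Counting (em : ExcludedMiddle 0ℓ) {S : Set} where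

  count : (S → Set) → List S → ℕ
  count Q []       = 0
  count Q (x ∷ xs) with em {Q x}
  ... | yes _ = suc (count Q xs)
  ... | no _  = count Q xs

  count-≤-length : ∀ Q xs → count Q xs ≤ length xs
  count-≤-length Q []       = z≤n
  count-≤-length Q (x ∷ xs) with em {Q x}
  ... | yes _ = s≤s (count-≤-length Q xs)
  ... | no _  = m≤n⇒m≤1+n (count-≤-length Q xs)

  count-mono : ∀ Q Q′ xs → (∀ {x} → x ∈ xs → Q x → Q′ x) → count Q xs ≤ count Q′ xs
  count-mono Q Q′ []       Q⊆Q′ = z≤n
  count-mono Q Q′ (x ∷ xs) Q⊆Q′ with em {Q x} | em {Q′ x}
  ... | yes _  | yes _   = s≤s (count-mono Q Q′ xs (Q⊆Q′ ∘ there))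
  ... | yes q  | no ¬q′  = ⊥-elim (¬q′ (Q⊆Q′ (here refl) q))
  ... | no _   | yes _   = m≤n⇒m≤1+n (count-mono Q Q′ xs (Q⊆Q′ ∘ there))
  ... | no _   | no _    = count-mono Q Q′ xs (Q⊆Q′ ∘ there)

  count-mono-< : ∀ Q Q′ xs → (∀ {x} → x ∈ xs → Q x → Q′ x) →
                 (Σ S λ x → x ∈ xs × Q′ x × ¬ Q x) → count Q xs < count Q′ xs
  count-mono-< Q Q′ (y ∷ xs) Q⊆Q′ (x , here refl , q′ , ¬q) with em {Q x} | em {Q′ x}
  ... | yes q | _      = ⊥-elim (¬q q)
  ... | no _  | yes _  = s≤s (count-mono Q Q′ xs (Q⊆Q′ ∘ there))
  ... | no _  | no ¬q′ = ⊥-elim (¬q′ q′)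
  count-mono-< Q Q′ (y ∷ xs) Q⊆Q′ (x , there x∈xs , new) with em {Q y} | em {Q′ y}
  ... | yes _ | yes _   = s≤s (count-mono-< Q Q′ xs (Q⊆Q′ ∘ there) (x , x∈xs , new))
  ... | yes q | no ¬q′  = ⊥-elim (¬q′ (Q⊆Q′ (here refl) q))
  ... | no _  | yes _   = m≤n⇒m≤1+n (count-mono-< Q Q′ xs (Q⊆Q′ ∘ there) (x , x∈xs , new))
  ... | no _  | no _    = count-mono-< Q Q′ xs (Q⊆Q′ ∘ there) (x , x∈xs , new)

Finite : Set → Set
Finite S = ∃[ k ] (S ↔ Fin k)

⊤-finite : Finite ⊤
⊤-finite = 1 , ↔-sym 1↔⊤

Bool-finite : Finite Bool
Bool-finite = 2 , ↔-sym 2↔Bool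

Fin-finite : ∀ k → Finite (Fin k)
Fin-finite k = k , ↔-refl

×-finite : ∀ {S T} → Finite S → Finite T → Finite (S × T)
×-finite (k , S↔) (l , T↔) = k * l , ↔-trans (S↔ ×-↔ T↔) (↔-sym *↔×)

⊎-finite : ∀ {S T} → Finite S → Finite T → Finite (S ⊎ T)
⊎-finite (k , S↔) (l , T↔) = k + l , ↔-trans (S↔ ⊎-↔ T↔) (↔-sym +↔⊎)

Vec-[]↔⊤ : ∀ {S : Set} → Vec S zero ↔ ⊤
Vec-[]↔⊤ = mk↔ₛ′ (λ _ → tt) (λ _ → []) (λ _ → refl) (λ { [] → refl })

Vec-∷↔× : ∀ {S : Set} {n} → Vec S (suc n) ↔ (S × Vec S n)
Vec-∷↔× = mk↔ₛ′ (λ { (x ∷ xs) → x , xs }) (λ (x , xs) → x ∷ xs) (λ _ → refl) (λ { (x ∷ xs) → refl })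

Vec-finite : ∀ {S} → Finite S → ∀ n → Finite (Vec S n)
Vec-finite S-finite zero    = 1 , ↔-trans Vec-[]↔⊤ (↔-sym 1↔⊤)
Vec-finite S-finite (suc n) =
  let (k , S×Vec↔) = ×-finite S-finite (Vec-finite S-finite n) in k , ↔-trans Vec-∷↔× S×Vec↔

-- Atoms: maximal consistent conjunctions of literals

module Atoms (em : ExcludedMiddle 0ℓ) (𝓣 : Theory) where
  open Derived 𝓣

  literal : Fm → Bool → Fm
  literal φ true  = φ
  literal φ false = ¬' φ

  ⋀ : (Ψ : List Fm) → Vec Bool (length Ψ) → Fm
  ⋀ []      []      = ⊤'
  ⋀ (φ ∷ Ψ) (b ∷ v) = literal φ b ∧' ⋀ Ψ v

  consistent-literal : Consistent X → ∀ φ → Σ Bool λ b → Consistent (X ∧' literal φ b)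
  consistent-literal {X} X-cons φ with em {Thm (¬' (X ∧' φ))}
  ... | no X∧φ-cons = true , X∧φ-cons
  ... | yes ⊢¬X∧φ   = false , λ ⊢¬X∧¬φ →
    X-cons (mp₂ (tauto (¬ₛ (p₀ ∧ₛ p₁) ⇒ₛ ¬ₛ (p₀ ∧ₛ ¬ₛ p₁) ⇒ₛ ¬ₛ p₀) (X ∷ φ ∷ [])) ⊢¬X∧φ ⊢¬X∧¬φ)

  extend : ∀ Ψ → Consistent X → Σ (Vec Bool (length Ψ)) λ v → Consistent (X ∧' ⋀ Ψ v)
  extend {X} [] X-cons = [] , λ ⊢¬X∧⊤ → X-cons (⇒-trans (tauto (p₀ ⇒ₛ p₀ ∧ₛ ⊤ₛ) (X ∷ [])) ⊢¬X∧⊤)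
  extend {X} (φ ∷ Ψ) X-cons =
    let (b , X∧φ-cons) = consistent-literal X-cons φ
        (v , X∧φ∧v-cons) = extend Ψ X∧φ-cons
    in b ∷ v , X∧φ∧v-cons ∘ ⇒-trans (tauto ((p₀ ∧ₛ p₁) ∧ₛ p₂ ⇒ₛ p₀ ∧ₛ p₁ ∧ₛ p₂) (X ∷ literal φ b ∷ ⋀ Ψ v ∷ []))

  ⋀-decides : ∀ {φ} Ψ v → φ ∈ Ψ → ⋀ Ψ v ⊢ₕ φ ⊎ ⋀ Ψ v ⊢ₕ ¬' φ
  ⋀-decides (φ ∷ Ψ) (true  ∷ v) (here refl) = inj₁ (⊢ₕ-fst ⊢ₕ-refl)
  ⋀-decides (φ ∷ Ψ) (false ∷ v) (here refl) = inj₂ (⊢ₕ-fst ⊢ₕ-refl)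
  ⋀-decides (ψ ∷ Ψ) (b ∷ v)     (there φ∈Ψ) = Sum.map ⊢ₕ-∧ʳ ⊢ₕ-∧ʳ (⋀-decides Ψ v φ∈Ψ)

  □-unfold : Fm → Fm
  □-unfold (□ G) = □ G ∧' G
  □-unfold _     = ⊤'

  ⇒□□-unfold : ∀ φ → Thm (φ ⇒ □ (□-unfold φ))
  ⇒□□-unfold (□ G)    = mp₂ (tauto ((p₀ ⇒ₛ p₁) ⇒ₛ (p₁ ⇒ₛ p₀ ⇒ₛ p₂) ⇒ₛ p₀ ⇒ₛ p₂) (□ G ∷ □ (□ G) ∷ □ (□ G ∧' G) ∷ []))
                            (□-4 G) (□-∧ (□ G) G)
  ⇒□□-unfold (var p)  = ⊢ₕ-const □-⊤
  ⇒□□-unfold ⊤'       = ⊢ₕ-const □-⊤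
  ⇒□□-unfold ⊥'       = ⊢ₕ-const □-⊤
  ⇒□□-unfold (A ⇒ B)  = ⊢ₕ-const □-⊤
  ⇒□□-unfold (A ∨' B) = ⊢ₕ-const □-⊤
  ⇒□□-unfold (A ∧' B) = ⊢ₕ-const □-⊤
  ⇒□□-unfold (A ▷ B)  = ⊢ₕ-const □-⊤

  -- What a maximal consistent set passes on to every successor: □ G ∧ G for each □ G it contains.
  □-part : (Ψ : List Fm) → Vec Bool (length Ψ) → Fm
  □-part []      []          = ⊤'
  □-part (φ ∷ Ψ) (true  ∷ v) = □-unfold φ ∧' □-part Ψ v
  □-part (φ ∷ Ψ) (false ∷ v) = □-part Ψ v

  ⋀⇒□□-part : ∀ Ψ v → ⋀ Ψ v ⊢ₕ □ (□-part Ψ v)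
  ⋀⇒□□-part []      []          = ⊢ₕ-const □-⊤
  ⋀⇒□□-part (φ ∷ Ψ) (true  ∷ v) = ⊢ₕ-□-∧ (⇒-trans (⊢ₕ-fst ⊢ₕ-refl) (⇒□□-unfold φ)) (⊢ₕ-∧ʳ (⋀⇒□□-part Ψ v))
  ⋀⇒□□-part (φ ∷ Ψ) (false ∷ v) = ⊢ₕ-∧ʳ (⋀⇒□□-part Ψ v)

  □-part-unfolds : ∀ Ψ v → □ G ∈ Ψ → ⋀ Ψ v ⊢ₕ ¬' (□ G) ⊎ □-part Ψ v ⊢ₕ □ G ∧' G
  □-part-unfolds (_ ∷ Ψ) (true  ∷ v) (here refl) = inj₂ (⊢ₕ-fst ⊢ₕ-refl)
  □-part-unfolds (_ ∷ Ψ) (false ∷ v) (here refl) = inj₁ (⊢ₕ-fst ⊢ₕ-refl)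
  □-part-unfolds (_ ∷ Ψ) (true  ∷ v) (there m)   = Sum.map ⊢ₕ-∧ʳ ⊢ₕ-∧ʳ (□-part-unfolds Ψ v m)
  □-part-unfolds (_ ∷ Ψ) (false ∷ v) (there m)   = Sum.map ⊢ₕ-∧ʳ id (□-part-unfolds Ψ v m)

  disjunction : List Bool → List Fm → Fm
  disjunction (b ∷ bs) (E ∷ Ψ) = (if b then E else ⊥') ∨' disjunction bs Ψ
  disjunction _        _       = ⊥'

  disjunction-intro : ∀ (f : Fm → Bool) Ψ → E ∈ Ψ → T (f E) → Thm (E ⇒ disjunction (map f Ψ) Ψ)
  disjunction-intro f (E ∷ Ψ) (here refl) fE =
    ⇒-trans (selected (f E) fE) (tauto (p₀ ⇒ₛ p₀ ∨ₛ p₁) (_ ∷ disjunction (map f Ψ) Ψ ∷ []))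
    where
      selected : ∀ b → T b → Thm (E ⇒ (if b then E else ⊥'))
      selected true _ = ⊢ₕ-refl
  disjunction-intro f (E′ ∷ Ψ) (there E∈Ψ) fE =
    ⇒-trans (disjunction-intro f Ψ E∈Ψ fE) (tauto (p₁ ⇒ₛ p₀ ∨ₛ p₁) ((if f E′ then E′ else ⊥') ∷ _ ∷ []))

  disjunction-▷ : ∀ (f : Fm → Bool) Ψ → (∀ {E} → E ∈ Ψ → T (f E) → G ⊢ₕ E ▷ D) → G ⊢ₕ disjunction (map f Ψ) Ψ ▷ D
  disjunction-▷ {D = D} f []      _   = ⊢ₕ-const (⊥▷ D)
  disjunction-▷ {D = D} f (E ∷ Ψ) E▷D = ⊢ₕ-J3 (selected (f E) (E▷D (here refl))) (disjunction-▷ f Ψ (E▷D ∘ there))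
    where
      selected : ∀ b → (T b → _ ⊢ₕ E ▷ D) → _ ⊢ₕ (if b then E else ⊥') ▷ D
      selected true  E▷D = E▷D tt
      selected false _   = ⊢ₕ-const (⊥▷ D)

-- The finite countermodel

S-Reflexive : Logic → Set
S-Reflexive IL⁻J2₊ = ⊥
S-Reflexive CL     = ⊤

-- The formula a world must refute in order to refute D at all its S-successors
-- (itself included when S is reflexive).
self : Logic → Fm → Fm
self IL⁻J2₊ D = ⊥'
self CL     D = D

self-reflexive : ∀ L D → S-Reflexive L → self L D ≡ D
self-reflexive CL D _ = refl

self-▷ : ∀ L D → Theory.Thm (theory L) (self L D ▷ D)
self-▷ IL⁻J2₊ D = Derived.⊥▷ IL⁻J2₊-theory D
self-▷ CL     D = CL-▷-refl D

self-∈ : ∀ L → D ∈ Ψ → self L D ∈ ⊥' ∷ Ψ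
self-∈ IL⁻J2₊ _   = here refl
self-∈ CL     D∈Ψ = there D∈Ψ

SCond-intro : ∀ L F → (S-Reflexive L → Reflexive (S F)) → Transitive (S F) → SCond L F
SCond-intro IL⁻J2₊ F _      S-trans = S-trans
SCond-intro CL     F S-refl S-trans = S-refl tt , S-trans

theory-⊢ : ∀ L → Theory.Thm (theory L) A → L ⊢ A
theory-⊢ IL⁻J2₊ ⊢A = ⊢A
theory-⊢ CL     ⊢A = ⊢A

module Completeness (em : ExcludedMiddle 0ℓ) (L : Logic) (A₀ : Fm) where
  open Derived (theory L)
  open Atoms em (theory L)
  open Counting em

  Σ₀ Σ⊥ Lhs : List Fm
  Σ₀  = sub A₀
  Σ⊥  = ⊥' ∷ Σ₀
  Lhs = concatMap antecedents Σ₀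

  masks : List (List Bool)
  masks = allBoolLists (length Lhs)

  marker : Fm → Fm → List Bool → Fm
  marker P D bs = □ (P ⇒ D ∨' disjunction bs Lhs)

  -- Refuting the marker □ (P ⇒ N ∨ ⋁ S) yields a successor containing P, ¬ N and ¬ E for E ∈ S.
  opaque
    Φ : List Fm
    Φ = Σ⊥ ++ Lhs ++ map (λ E → □ (¬' E)) Lhs
          ++ concatMap (λ P → concatMap (λ D → map (marker P D) masks) Σ⊥) Σ⊥

    Σ⊥⊆Φ : Σ⊥ ⊆ Φ
    Σ⊥⊆Φ = ∈-++⁺ˡ

    Lhs⊆Φ : Lhs ⊆ Φ
    Lhs⊆Φ E∈ = ∈-++⁺ʳ Σ⊥ (∈-++⁺ˡ E∈)

    □¬Lhs⊆Φ : E ∈ Lhs → □ (¬' E) ∈ Φ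
    □¬Lhs⊆Φ E∈ = ∈-++⁺ʳ Σ⊥ (∈-++⁺ʳ Lhs (∈-++⁺ˡ (∈-map⁺ (λ E → □ (¬' E)) E∈)))

    marker∈Φ : ∀ {bs} → P ∈ Σ⊥ → D ∈ Σ⊥ → bs ∈ masks → marker P D bs ∈ Φ
    marker∈Φ {P} {D} P∈ D∈ bs∈ =
      ∈-++⁺ʳ Σ⊥ (∈-++⁺ʳ Lhs (∈-++⁺ʳ (map (λ E → □ (¬' E)) Lhs)
        (∈-concatMap {f = λ P → concatMap (λ D → map (marker P D) masks) Σ⊥} P∈
          (∈-concatMap {f = λ D → map (marker P D) masks} D∈ (∈-map⁺ (marker P D) bs∈)))))

  Σ₀⊆Φ : Σ₀ ⊆ Φ
  Σ₀⊆Φ A∈ = Σ⊥⊆Φ (there A∈)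

  antecedent∈Lhs : (C ▷ D) ∈ Σ₀ → C ∈ Lhs
  antecedent∈Lhs C▷D∈ = ∈-concatMap C▷D∈ (here refl)

  Atom : Set
  Atom = Vec Bool (length Φ)

  infix 3 _∋_
  _∋_ : Atom → Fm → Set
  u ∋ A = ⋀ Φ u ⊢ₕ A

  ConsistentAtom : Atom → Set
  ConsistentAtom u = Consistent (⋀ Φ u)

  ∋-contradiction : ∀ {u} → ConsistentAtom u → u ∋ A → u ∋ ¬' A → ⊥
  ∋-contradiction u-cons u∋A u∋¬A = u-cons (⊢ₕ-mp u∋¬A u∋A)

  data Literal : Fm → Set where
    pos : Y ∈ Φ → Literal Y
    neg : Y ∈ Φ → Literal (¬' Y)

  record _Extends_ (w : Atom) (X : Fm) : Set where
    field
      consistent : ConsistentAtom w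
      ∋-literal  : Literal Y → Thm (X ⇒ Y) → w ∋ Y
  open _Extends_

  Extends-mono : ∀ {w} → Thm (X ⇒ Y) → w Extends X → w Extends Y
  Extends-mono X⇒Y w-ext = record
    { consistent = consistent w-ext ; ∋-literal = λ lit Y⇒Z → ∋-literal w-ext lit (⇒-trans X⇒Y Y⇒Z) }

  consistent-extension : ∀ {w} → Consistent (X ∧' ⋀ Φ w) → w Extends X
  consistent-extension {X} {w} X∧w-cons = record { consistent = w-cons ; ∋-literal = literal∈w }
    where
      w-cons : ConsistentAtom w
      w-cons ⊢¬w = X∧w-cons (⇒-trans (tauto (p₀ ∧ₛ p₁ ⇒ₛ p₁) (X ∷ ⋀ Φ w ∷ [])) ⊢¬w)

      clash : Thm (X ⇒ Y) → w ∋ ¬' Y → ⊥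
      clash {Y} X⇒Y w∋¬Y =
        X∧w-cons (mp₂ (tauto ((p₀ ⇒ₛ p₁) ⇒ₛ (p₂ ⇒ₛ p₁ ⇒ₛ ⊥ₛ) ⇒ₛ p₀ ∧ₛ p₂ ⇒ₛ ⊥ₛ) (X ∷ Y ∷ ⋀ Φ w ∷ [])) X⇒Y w∋¬Y)

      literal∈w : Literal Y → Thm (X ⇒ Y) → w ∋ Y
      literal∈w (pos Y∈Φ) X⇒Y with ⋀-decides Φ w Y∈Φ
      ... | inj₁ w∋Y  = w∋Y
      ... | inj₂ w∋¬Y = ⊥-elim (clash X⇒Y w∋¬Y)
      literal∈w (neg {Y} Y∈Φ) X⇒¬Y with ⋀-decides Φ w Y∈Φ
      ... | inj₁ w∋Y  = ⊥-elim (clash X⇒¬Y (⊢ₕ-map (tauto (p₀ ⇒ₛ ¬ₛ ¬ₛ p₀) (Y ∷ [])) w∋Y))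
      ... | inj₂ w∋¬Y = w∋¬Y

  lindenbaum : Consistent X → Σ Atom (_Extends X)
  lindenbaum X-cons = let (w , X∧w-cons) = extend Φ X-cons in w , consistent-extension X∧w-cons

  record _≺_ (u w : Atom) : Set where
    field
      keeps-□ : ∀ {G} → □ G ∈ Φ → u ∋ □ G → w ∋ □ G
      unboxes : ∀ {G} → □ G ∈ Φ → u ∋ □ G → Literal G → w ∋ G
      new-□   : Σ Fm λ F → □ F ∈ Φ × w ∋ □ F × ¬ (u ∋ □ F)
  open _≺_

  ≺-trans : ∀ {u v w} → u ≺ v → v ≺ w → u ≺ w
  ≺-trans u≺v v≺w = record
    { keeps-□ = λ m u∋□G → keeps-□ v≺w m (keeps-□ u≺v m u∋□G)
    ; unboxes = λ m u∋□G → unboxes v≺w m (keeps-□ u≺v m u∋□G)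
    ; new-□   = let (F , m , w∋□F , v∌□F) = new-□ v≺w in F , m , w∋□F , v∌□F ∘ keeps-□ u≺v m }

  ≺-irrefl : ∀ {u} → ¬ u ≺ u
  ≺-irrefl u≺u = let (_ , _ , u∋□F , u∌□F) = new-□ u≺u in u∌□F u∋□F

  □-part-unfolds-∋ : ∀ {u} → ConsistentAtom u → □ G ∈ Φ → u ∋ □ G → □-part Φ u ⊢ₕ □ G ∧' G
  □-part-unfolds-∋ {u = u} u-cons □G∈Φ u∋□G with □-part-unfolds Φ u □G∈Φ
  ... | inj₁ u∋¬□G = ⊥-elim (∋-contradiction u-cons u∋□G u∋¬□G)
  ... | inj₂ unfolds = unfolds

  -- Löb's axiom is what makes a successor refuting M possible.
  successor : ∀ {u} → □ M ∈ Φ → ConsistentAtom u → ¬ (u ∋ □ M) → Σ Atom λ w → u ≺ w × w Extends ¬' M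
  successor {M} {u} □M∈Φ u-cons u∌□M =
    let (w , w-ext) = lindenbaum Γ-cons in
    w , u≺-extension w-ext , Extends-mono (tauto (p₀ ∧ₛ p₁ ∧ₛ p₂ ⇒ₛ p₁) (Δ ∷ ¬' M ∷ □ M ∷ [])) w-ext
    where
      Δ Γ : Fm
      Δ = □-part Φ u
      Γ = Δ ∧' ¬' M ∧' □ M

      Γ-cons : Consistent Γ
      Γ-cons ⊢¬Γ = u∌□M (⇒-trans (⋀⇒□□-part Φ u) (⇒-trans (□-mono Δ⇒□M⇒M) (ax-Löb M)))
        where
          Δ⇒□M⇒M : Thm (Δ ⇒ □ M ⇒ M)
          Δ⇒□M⇒M = mp (tauto ((p₀ ∧ₛ ¬ₛ p₁ ∧ₛ p₂ ⇒ₛ ⊥ₛ) ⇒ₛ p₀ ⇒ₛ p₂ ⇒ₛ p₁) (Δ ∷ M ∷ □ M ∷ [])) ⊢¬Γ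

      Γ⇒Δ : Thm (Γ ⇒ Δ)
      Γ⇒Δ = tauto (p₀ ∧ₛ p₁ ∧ₛ p₂ ⇒ₛ p₀) (Δ ∷ ¬' M ∷ □ M ∷ [])

      u≺-extension : ∀ {w} → w Extends Γ → u ≺ w
      u≺-extension w-ext = record
        { keeps-□ = λ {G} □G∈Φ u∋□G → ∋-literal w-ext (pos □G∈Φ)
            (⇒-trans Γ⇒Δ (⇒-trans (□-part-unfolds-∋ u-cons □G∈Φ u∋□G) (tauto (p₀ ∧ₛ p₁ ⇒ₛ p₀) (□ G ∷ G ∷ []))))
        ; unboxes = λ {G} □G∈Φ u∋□G G-lit → ∋-literal w-ext G-lit
            (⇒-trans Γ⇒Δ (⇒-trans (□-part-unfolds-∋ u-cons □G∈Φ u∋□G) (tauto (p₀ ∧ₛ p₁ ⇒ₛ p₁) (□ G ∷ G ∷ []))))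
        ; new-□ = M , □M∈Φ , ∋-literal w-ext (pos □M∈Φ) (tauto (p₀ ∧ₛ p₁ ∧ₛ p₂ ⇒ₛ p₂) (Δ ∷ ¬' M ∷ □ M ∷ [])) , u∌□M }

  Boxed : Atom → Fm → Set
  Boxed u φ = (Σ Fm λ G → φ ≡ □ G) × u ∋ φ

  ≺-count : ∀ {u w} → u ≺ w → count (Boxed u) Φ < count (Boxed w) Φ
  ≺-count u≺w =
    let (F , □F∈Φ , w∋□F , u∌□F) = new-□ u≺w in
    count-mono-< (Boxed _) (Boxed _) Φ (λ { m ((G , refl) , u∋□G) → (G , refl) , keeps-□ u≺w m u∋□G })
      (□ F , □F∈Φ , ((F , refl) , w∋□F) , λ (_ , u∋□F) → u∌□F u∋□F)

  ≻-wellFounded : WellFounded (λ w u → u ≺ w)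
  ≻-wellFounded = Subrelation.wellFounded ≺-decreases (On.wellFounded unboxed <-wellFounded)
    where
      unboxed : Atom → ℕ
      unboxed u = length Φ ∸ count (Boxed u) Φ

      ≺-decreases : ∀ {w u} → u ≺ w → unboxed w < unboxed u
      ≺-decreases {w} u≺w = ∸-monoʳ-< (≺-count u≺w) (count-≤-length (Boxed w) Φ)

  -- A world tagged (o , v , j) serves, when v is its predecessor's atom, to refute v ∋ C ▷ Σ⊥[j]:
  -- the source of the refutation (o = true) S-reaches only the targets (o = false) with the same v and j,
  -- and both are required to be Σ⊥[j]-critical for v; the condition ¬ v ≺ u keeps R transitive.
  Tag : Set
  Tag = ⊤ ⊎ (Bool × Atom × Fin (length Σ⊥))

  pattern plain = inj₁ tt
  pattern tagged o v j = inj₂ (o , v , j)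

  World : Set
  World = Atom × Tag

  Critical : Atom → Fm → Atom → Set
  Critical u D w = ∀ {E} → E ∈ Lhs → u ∋ E ▷ D → w ∋ ¬' E

  refuted : Bool → Fm → Fm
  refuted true  D = self L D
  refuted false D = D

  TagOK : Atom → Tag → Atom → Set
  TagOK u plain          w = ⊤
  TagOK u (tagged o v j) w = ¬ v ≺ u × (v ≡ u → w ∋ ¬' (refuted o (lookup Σ⊥ j)) × Critical u (lookup Σ⊥ j) w)

  record _Rᵐ_ (x y : World) : Set where
    constructor R-intro
    field
      consistent : ConsistentAtom (proj₁ y)
      ≺-atoms    : proj₁ x ≺ proj₁ y
      tag-ok     : TagOK (proj₁ x) (proj₂ y) (proj₁ y)

  data _Sᵐ_ : World → World → Set where
    from-plain : ∀ {u w t} → (u , plain) Sᵐ (w , t)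
    to-target  : ∀ {u w o v j} → (u , tagged o v j) Sᵐ (w , tagged false v j)
    reflexive  : ∀ {x} → S-Reflexive L → x Sᵐ x

  R-trans : ∀ {x y z} → x Rᵐ y → y Rᵐ z → x Rᵐ z
  R-trans {z = w , plain} (R-intro _ u≺v _) (R-intro w-cons v≺w _) = R-intro w-cons (≺-trans u≺v v≺w) tt
  R-trans {z = w , tagged o u′ j} (R-intro _ u≺v _) (R-intro w-cons v≺w (¬u′≺v , _)) =
    R-intro w-cons (≺-trans u≺v v≺w) ((λ u′≺u → ¬u′≺v (≺-trans u′≺u u≺v)) , λ { refl → ⊥-elim (¬u′≺v u≺v) })

  R-wellFounded : WellFounded (λ y x → x Rᵐ y)
  R-wellFounded = Subrelation.wellFounded _Rᵐ_.≺-atoms (On.wellFounded proj₁ ≻-wellFounded)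

  S-trans : ∀ {x y z} → x Sᵐ y → y Sᵐ z → x Sᵐ z
  S-trans from-plain    _             = from-plain
  S-trans to-target     to-target     = to-target
  S-trans xSy           (reflexive _) = xSy
  S-trans (reflexive _) ySz           = ySz

  model : Frame
  model = record { W = World ; R = _Rᵐ_ ; S = _Sᵐ_ }

  model-is-frame : IsSimplifiedLFrame L model
  model-is-frame = ((Vec.replicate _ false , plain) , R-trans , R-wellFounded)
                 , SCond-intro L model (λ refl-L → reflexive refl-L) S-trans

  model-finite : IsFinite model
  model-finite = ×-finite (Vec-finite Bool-finite _)
                          (⊎-finite ⊤-finite (×-finite Bool-finite (×-finite (Vec-finite Bool-finite _) (Fin-finite _))))

  valuation : World → ℕ → Set
  valuation (u , _) p = u ∋ var p

  open Forcing model valuation using (_⊩_)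

  ▷-antecedents : Atom → Fm → Fm
  ▷-antecedents u D = disjunction (map (λ E → isYes (em {u ∋ E ▷ D})) Lhs) Lhs

  ∋▷-antecedents▷ : ∀ {u} → u ∋ ▷-antecedents u D ▷ D
  ∋▷-antecedents▷ {D} {u} = disjunction-▷ _ Lhs (λ _ → toWitness {a? = em {u ∋ _ ▷ D}})

  ⇒▷-antecedents : ∀ {u} → E ∈ Lhs → u ∋ E ▷ D → Thm (E ⇒ ▷-antecedents u D)
  ⇒▷-antecedents {E} {D} {u} E∈ u∋E▷D = disjunction-intro _ Lhs E∈ (fromWitness {a? = em {u ∋ E ▷ D}} u∋E▷D)

  record CriticalSuccessor (u : Atom) (D P N : Fm) : Set where
    field
      atom       : Atom
      ≺-atom     : u ≺ atom
      consistent : ConsistentAtom atom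
      ∋P         : atom ∋ P
      ∋¬N        : atom ∋ ¬' N
      critical   : Critical u D atom
  open CriticalSuccessor

  critical-successor : ∀ {u N} → P ∈ Σ⊥ → N ∈ Σ⊥ → ConsistentAtom u →
                       ¬ (u ∋ □ (P ⇒ N ∨' ▷-antecedents u D)) → CriticalSuccessor u D P N
  critical-successor {P} {D} {u} {N} P∈ N∈ u-cons u∌□ =
    let (w , u≺w , w-ext) = successor (marker∈Φ P∈ N∈ (∈-allBoolLists-map _ Lhs)) u-cons u∌□
        ¬marker⇒ : ∀ {Y} → Literal Y → Thm (¬' (P ⇒ N ∨' Z) ⇒ Y) → w ∋ Y
        ¬marker⇒ = ∋-literal w-ext
    in record
      { atom       = w
      ; ≺-atom     = u≺w
      ; consistent = consistent w-ext
      ; ∋P         = ¬marker⇒ (pos (Σ⊥⊆Φ P∈)) (tauto (¬ₛ (p₀ ⇒ₛ p₁ ∨ₛ p₂) ⇒ₛ p₀) (P ∷ N ∷ Z ∷ []))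
      ; ∋¬N        = ¬marker⇒ (neg (Σ⊥⊆Φ N∈)) (tauto (¬ₛ (p₀ ⇒ₛ p₁ ∨ₛ p₂) ⇒ₛ ¬ₛ p₁) (P ∷ N ∷ Z ∷ []))
      ; critical   = λ E∈ u∋E▷D → ¬marker⇒ (neg (Lhs⊆Φ E∈))
          (mp (tauto ((p₃ ⇒ₛ p₂) ⇒ₛ ¬ₛ (p₀ ⇒ₛ p₁ ∨ₛ p₂) ⇒ₛ ¬ₛ p₃) (P ∷ N ∷ Z ∷ _ ∷ [])) (⇒▷-antecedents E∈ u∋E▷D))
      }
    where
      Z : Fm
      Z = ▷-antecedents u D

  -- J4₊ and J2₊ turn □ (D ⇒ N ∨ Z) into C ▷ N.
  ▷-successor : ∀ {u N} → D ∈ Σ₀ → N ∈ Σ⊥ → ConsistentAtom u → u ∋ C ▷ D → ¬ (u ∋ C ▷ N) → CriticalSuccessor u N D N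
  ▷-successor {D} {C} {u} {N} D∈ N∈ u-cons u∋C▷D u∌C▷N = critical-successor (there D∈) N∈ u-cons λ u∋□ →
    u∌C▷N (⊢ₕ-J2₊ (⊢ₕ-J4₊ u∋C▷D (⊢ₕ-□-mono (tauto ((p₀ ⇒ₛ p₁ ∨ₛ p₂) ⇒ₛ p₀ ⇒ₛ p₂ ∨ₛ p₁) (D ∷ N ∷ Z ∷ [])) u∋□))
                  ∋▷-antecedents▷)
    where
      Z : Fm
      Z = ▷-antecedents u N

  TruthFor : Fm → Set
  TruthFor X = ∀ {u s} → ConsistentAtom u → ((u , s) ⊩ X) ⇔ (u ∋ X)

  open Equivalence using (to; from)

  ∋⇒⊩▷ : (C ▷ D) ∈ Σ₀ → D ∈ Σ₀ → TruthFor C → TruthFor D →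
         ∀ {u s} → ConsistentAtom u → u ∋ C ▷ D → (u , s) ⊩ C ▷ D
  ∋⇒⊩▷ {C} {D} C▷D∈ D∈ C-truth D-truth {u} {s} u-cons u∋C▷D (w′ , t) (R-intro w′-cons u≺w′ t-ok) w′⊩C =
    S-successor t t-ok
    where
      C∈Lhs : C ∈ Lhs
      C∈Lhs = antecedent∈Lhs C▷D∈

      w′∋C : w′ ∋ C
      w′∋C = to (C-truth w′-cons) w′⊩C

      Goal : Tag → Set
      Goal t = Σ World λ z → (u , s) Rᵐ z × (w′ , t) Sᵐ z × z ⊩ D

      into : ∀ {N t} (cs : CriticalSuccessor u N D N) t′ → TagOK u t′ (atom cs) → (w′ , t) Sᵐ (atom cs , t′) → Goal t
      into cs t′ t′-ok S-step =
        (atom cs , t′) , R-intro (consistent cs) (≺-atom cs) t′-ok , S-step , from (D-truth (consistent cs)) (∋P cs)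

      -- C ▷ ⊥ at u would put ¬ C into the successor w′.
      plain-successor : CriticalSuccessor u ⊥' D ⊥'
      plain-successor = ▷-successor D∈ (here refl) u-cons u∋C▷D λ u∋C▷⊥ →
        ∋-contradiction w′-cons w′∋C (unboxes u≺w′ (□¬Lhs⊆Φ C∈Lhs) (⊢ₕ-map (J6⇐ C) u∋C▷⊥) (neg (Lhs⊆Φ C∈Lhs)))

      S-successor : ∀ t → TagOK u t w′ → Goal t
      S-successor plain _ = into plain-successor plain tt from-plain
      S-successor (tagged o v j) (¬v≺u , v-critical) with em {v ≡ u}
      ... | no v≢u   = into plain-successor (tagged false v j) (¬v≺u , ⊥-elim ∘ v≢u) to-target
      ... | yes refl =
        let cs = ▷-successor D∈ (∈-lookup j) u-cons u∋C▷D λ u∋C▷Dⱼ →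
                   ∋-contradiction w′-cons w′∋C (proj₂ (v-critical refl) C∈Lhs u∋C▷Dⱼ)
        in into cs (tagged false u j) (¬v≺u , λ _ → ∋¬N cs , critical cs) to-target

  ⊩▷⇒∋ : C ∈ Σ₀ → D ∈ Σ₀ → TruthFor C → TruthFor D →
         ∀ {u s} → ConsistentAtom u → (u , s) ⊩ C ▷ D → u ∋ C ▷ D
  ⊩▷⇒∋ {C} {D} C∈ D∈ C-truth D-truth {u} {s} u-cons ⊩C▷D with em {u ∋ C ▷ D}
  ... | yes u∋C▷D = u∋C▷D
  ... | no u∌C▷D  = ⊥-elim (no-S-successor (⊩C▷D y u-Rᵐ-y (from (C-truth (consistent cs)) (∋P cs))))
    where
      D∈Σ⊥ : D ∈ Σ⊥
      D∈Σ⊥ = there D∈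

      j : Fin (length Σ⊥)
      j = index D∈Σ⊥

      D≡Dⱼ : D ≡ lookup Σ⊥ j
      D≡Dⱼ = lookup-index D∈Σ⊥

      cs : CriticalSuccessor u D C (self L D)
      cs = critical-successor (there C∈) (self-∈ L D∈) u-cons λ u∋□ →
             u∌C▷D (⊢ₕ-□▷ u∋□ (⊢ₕ-J3 (⊢ₕ-const (self-▷ L D)) ∋▷-antecedents▷))

      y : World
      y = atom cs , tagged true u j

      u-Rᵐ-y : (u , s) Rᵐ y
      u-Rᵐ-y = R-intro (consistent cs) (≺-atom cs)
        (≺-irrefl , λ _ → subst (λ Dⱼ → atom cs ∋ ¬' (self L Dⱼ) × Critical u Dⱼ (atom cs)) D≡Dⱼ (∋¬N cs , critical cs))

      no-S-successor : ¬ (Σ World λ z → (u , s) Rᵐ z × y Sᵐ z × z ⊩ D)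
      no-S-successor (_ , _ , reflexive S-refl , y⊩D) =
        ∋-contradiction (consistent cs) (to (D-truth (consistent cs)) y⊩D)
          (subst (λ X → atom cs ∋ ¬' X) (self-reflexive L D S-refl) (∋¬N cs))
      no-S-successor ((w , _) , R-intro w-cons _ (_ , w-critical) , to-target , w⊩D) =
        ∋-contradiction w-cons (to (D-truth w-cons) w⊩D) (subst (λ X → w ∋ ¬' X) (sym D≡Dⱼ) (proj₁ (w-critical refl)))

  truth : ∀ X → sub X ⊆ Σ₀ → TruthFor X
  truth (var p)  _    _ = mk⇔ id id
  truth ⊤'       _    _ = mk⇔ (λ _ → ⊢ₕ-const (tauto ⊤ₛ [])) (λ _ → tt)
  truth ⊥'       _    u-cons = mk⇔ (λ ()) (λ u∋⊥ → ⊥-elim (u-cons u∋⊥))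
  truth (B ⇒ C)  sub⊆ {u} {s} u-cons = mk⇔ ⇒-to ⇒-from
    where
      B-truth : ((u , s) ⊩ B) ⇔ (u ∋ B)
      B-truth = truth B (⊆-subˡ B C sub⊆) u-cons
      C-truth : ((u , s) ⊩ C) ⇔ (u ∋ C)
      C-truth = truth C (⊆-subʳ B C sub⊆) u-cons

      ⇒-to : (u , s) ⊩ B ⇒ C → u ∋ B ⇒ C
      ⇒-to ⊩B⇒C with ⋀-decides Φ u (Σ₀⊆Φ (⊆-subˡ B C sub⊆ sub-self))
      ... | inj₁ u∋B  = ⊢ₕ-map (tauto (p₁ ⇒ₛ p₀ ⇒ₛ p₁) (B ∷ C ∷ [])) (to C-truth (⊩B⇒C (from B-truth u∋B)))
      ... | inj₂ u∋¬B = ⊢ₕ-map (tauto (¬ₛ p₀ ⇒ₛ p₀ ⇒ₛ p₁) (B ∷ C ∷ [])) u∋¬B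

      ⇒-from : u ∋ B ⇒ C → (u , s) ⊩ B ⇒ C
      ⇒-from u∋B⇒C ⊩B = from C-truth (⊢ₕ-mp u∋B⇒C (to B-truth ⊩B))
  truth (B ∨' C) sub⊆ {u} {s} u-cons = mk⇔ ∨-to ∨-from
    where
      B-truth : ((u , s) ⊩ B) ⇔ (u ∋ B)
      B-truth = truth B (⊆-subˡ B C sub⊆) u-cons
      C-truth : ((u , s) ⊩ C) ⇔ (u ∋ C)
      C-truth = truth C (⊆-subʳ B C sub⊆) u-cons

      ∨-to : (u , s) ⊩ B ∨' C → u ∋ B ∨' C
      ∨-to (inj₁ ⊩B) = ⊢ₕ-map (tauto (p₀ ⇒ₛ p₀ ∨ₛ p₁) (B ∷ C ∷ [])) (to B-truth ⊩B)
      ∨-to (inj₂ ⊩C) = ⊢ₕ-map (tauto (p₁ ⇒ₛ p₀ ∨ₛ p₁) (B ∷ C ∷ [])) (to C-truth ⊩C)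

      ∨-from : u ∋ B ∨' C → (u , s) ⊩ B ∨' C
      ∨-from u∋B∨C with ⋀-decides Φ u (Σ₀⊆Φ (⊆-subˡ B C sub⊆ sub-self))
      ... | inj₁ u∋B  = inj₁ (from B-truth u∋B)
      ... | inj₂ u∋¬B = inj₂ (from C-truth (⊢ₕ-map₂ (tauto ((p₀ ∨ₛ p₁) ∧ₛ ¬ₛ p₀ ⇒ₛ p₁) (B ∷ C ∷ [])) u∋B∨C u∋¬B))
  truth (B ∧' C) sub⊆ u-cons =
    let B-truth = truth B (⊆-subˡ B C sub⊆) u-cons
        C-truth = truth C (⊆-subʳ B C sub⊆) u-cons
    in mk⇔ (λ (⊩B , ⊩C) → ⊢ₕ-pair (to B-truth ⊩B) (to C-truth ⊩C))
           (λ u∋B∧C → from B-truth (⊢ₕ-fst u∋B∧C) , from C-truth (⊢ₕ-snd u∋B∧C))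
  truth (□ G) sub⊆ {u} {s} u-cons = mk⇔ □-to □-from
    where
      G⊆ : sub G ⊆ Σ₀
      G⊆ m = sub⊆ (there m)

      □G∈Φ : □ G ∈ Φ
      □G∈Φ = Σ₀⊆Φ (sub⊆ sub-self)

      G∈Φ : G ∈ Φ
      G∈Φ = Σ₀⊆Φ (G⊆ sub-self)

      □-from : u ∋ □ G → (u , s) ⊩ □ G
      □-from u∋□G (w , _) (R-intro w-cons u≺w _) = from (truth G G⊆ w-cons) (unboxes u≺w □G∈Φ u∋□G (pos G∈Φ))

      □-to : (u , s) ⊩ □ G → u ∋ □ G
      □-to ⊩□G with em {u ∋ □ G}
      ... | yes u∋□G = u∋□G
      ... | no u∌□G  =
        let (w , u≺w , w-ext) = successor □G∈Φ u-cons u∌□G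
            w⊩G = ⊩□G (w , plain) (R-intro (consistent w-ext) u≺w tt)
        in ⊥-elim (∋-contradiction (consistent w-ext) (to (truth G G⊆ (consistent w-ext)) w⊩G)
                                   (∋-literal w-ext (neg G∈Φ) ⊢ₕ-refl))
  truth (C ▷ D)  sub⊆ u-cons =
    let C⊆ = ⊆-subˡ C D sub⊆
        D⊆ = ⊆-subʳ C D sub⊆
    in mk⇔ (⊩▷⇒∋ (C⊆ sub-self) (D⊆ sub-self) (truth C C⊆) (truth D D⊆) u-cons)
           (∋⇒⊩▷ (sub⊆ sub-self) (D⊆ sub-self) (truth C C⊆) (truth D D⊆) u-cons)

  countermodel : ¬ Thm A₀ → ¬ ValidFinite L A₀
  countermodel ⊬A₀ valid =
    let (w , w-ext) = lindenbaum ¬A₀-cons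
        w⊩A₀ = valid model model-is-frame model-finite valuation (w , plain)
    in ∋-contradiction (consistent w-ext) (to (truth A₀ id (consistent w-ext)) w⊩A₀)
                       (∋-literal w-ext (neg (Σ₀⊆Φ sub-self)) ⊢ₕ-refl)
    where
      ¬A₀-cons : Consistent (¬' A₀)
      ¬A₀-cons ⊢¬¬A₀ = ⊬A₀ (mp (tauto (¬ₛ ¬ₛ p₀ ⇒ₛ p₀) (A₀ ∷ [])) ⊢¬¬A₀)

complete : ExcludedMiddle 0ℓ → ∀ L {A} → ValidFinite L A → L ⊢ A
complete em L {A} valid with em {L ⊢ A}
... | yes ⊢A = ⊢A
... | no ⊬A  = ⊥-elim (Completeness.countermodel em L A (⊬A ∘ theory-⊢ L) valid)

theorem3p2 : ExcludedMiddle 0ℓ → (L : Logic) (A : Fm) →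
  (L ⊢ A ⇔ ValidAll L A) × (L ⊢ A ⇔ ValidFinite L A)
theorem3p2 em L A =
  mk⇔ (sound em L) (λ valid → complete em L (λ F F-frame _ → valid F F-frame)) ,
  mk⇔ (λ ⊢A F F-frame _ → sound em L ⊢A F F-frame) (complete em L)
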